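{- For every $n\geq 1$, the number of $D$-equivalence classes of the set $\mathcal{L}_n$ of Łukasiewicz paths of length $n$ is $2^{n-1}$.
   Context: A Łukasiewicz path of length $n$ is a sequence of $n$ steps from $\{(1,i): i\geq -1\}$ starting at $(0,0)$, ending at $(n,0)$ and never going below the $x$-axis. Write $D=(1,-1)$, $F=(1,0)$, $U_i=(1,i)$ for $i\geq1$. Steps are numbered $1,\dots,n$; an occurrence of a pattern is at position $i$ if its first step is the $i$-th step. Two paths of the same length are $\alpha$-equivalent if the sets of occurrence positions of the pattern $\alpha$ in them are identical. -}

module Defs where

open import Data.Nat using (ℕ; zero; suc; _+_)
open import Data.Bool using (Bool; true; false)
open import Data.Vec using (Vec; []; _∷_; map)
open import Relation.Binary.PropositionalEquality using (_≡_)

-- Steps of a Łukasiewicz path: D = (1,-1), F = (1,0), U i = (1, i+1)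
-- (so U 0 is the paper's U_1, U 1 is U_2, etc.)
data Step : Set where
  D : Step
  F : Step
  U : ℕ → Step

-- LukFrom h xs : the step sequence xs, started at height h, never goes
-- below the x-axis and ends at height 0.
data LukFrom : {n : ℕ} → ℕ → Vec Step n → Set where
  end  : LukFrom 0 []
  down : ∀ {n h} {xs : Vec Step n} → LukFrom h xs → LukFrom (suc h) (D ∷ xs)
  flat : ∀ {n h} {xs : Vec Step n} → LukFrom h xs → LukFrom h (F ∷ xs)
  up   : ∀ {n h} i {xs : Vec Step n} → LukFrom (suc i + h) xs → LukFrom h (U i ∷ xs)

IsLuk : {n : ℕ} → Vec Step n → Set
IsLuk p = LukFrom 0 p

isD : Step → Bool
isD D = true
isD F = false
isD (U _) = false

-- Set of occurrence positions of the pattern D, as a characteristic vector: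
-- entry k (0-based) is true iff step k+1 is D.
occD : {n : ℕ} → Vec Step n → Vec Bool n
occD = map isD

_≈D_ : {n : ℕ} → Vec Step n → Vec Step n → Set
p ≈D q = occD p ≡ occD q

-- The first step of a Łukasiewicz path is never D, so the D-occurrence vector
-- of a path of length m + 1 is false ∷ v for some v : Vec Bool m. Conversely
-- every such vector occurs: read v as a word in D and F and prefix it with the
-- step (F or an up-step) that climbs to exactly the number of D's in v. Hence
-- the D-classes are in bijection with Vec Bool m, and there are 2 ^ m of them.
module Submission where

open import Defs
open import Data.Nat using (ℕ; _≤_; _^_; _∸_; zero; suc; _+_; _*_)
open import Data.Nat.Properties using (+-identityʳ)
open import Data.Bool using (Bool; true; false)
open import Data.Vec using (Vec; []; _∷_; countᵇ)
import Data.Vec as Vec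
open import Data.Vec.Properties using (∷-injective; ∷-injectiveʳ)
open import Data.List using (List; length; []; _∷_; [_]; _++_; map; cartesianProductWith)
open import Data.List.Properties using (length-map; length-++)
open import Data.List.Membership.Propositional using (_∈_)
open import Data.List.Membership.Propositional.Properties
  using (∈-map⁺; ∈-cartesianProductWith⁺)
open import Data.List.Relation.Unary.All using (All)
import Data.List.Relation.Unary.All as All
import Data.List.Relation.Unary.All.Properties as All
open import Data.List.Relation.Unary.Any using (Any; here; there)
import Data.List.Relation.Unary.Any as Any
open import Data.List.Relation.Unary.AllPairs using (AllPairs; []; _∷_)
import Data.List.Relation.Unary.AllPairs as AllPairs
import Data.List.Relation.Unary.AllPairs.Properties as AllPairs
open import Data.List.Relation.Unary.Unique.Propositional using (Unique)
open import Data.List.Relation.Unary.Unique.Propositional.Properties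
  using (cartesianProductWith⁺)
open import Data.Product using (Σ; _×_; _,_)
open import Function using (id)
open import Relation.Nullary using (¬_)
open import Relation.Binary.PropositionalEquality
  using (_≡_; refl; sym; trans; cong; cong₂; subst; module ≡-Reasoning)

open ≡-Reasoning

length-cartesianProductWith : ∀ {a b c} {A : Set a} {B : Set b} {C : Set c}
  (f : A → B → C) xs ys →
  length (cartesianProductWith f xs ys) ≡ length xs * length ys
length-cartesianProductWith f []       ys = refl
length-cartesianProductWith f (x ∷ xs) ys = begin
  length (map (f x) ys ++ cartesianProductWith f xs ys)
    ≡⟨ length-++ (map (f x) ys) ⟩
  length (map (f x) ys) + length (cartesianProductWith f xs ys)
    ≡⟨ cong₂ _+_ (length-map (f x) ys) (length-cartesianProductWith f xs ys) ⟩
  length ys + length xs * length ys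
    ∎

module _ {a} {A : Set a} where

  vecsOver : List A → ∀ m → List (Vec A m)
  vecsOver xs zero    = [ [] ]
  vecsOver xs (suc m) = cartesianProductWith _∷_ xs (vecsOver xs m)

  length-vecsOver : ∀ xs m → length (vecsOver xs m) ≡ length xs ^ m
  length-vecsOver xs zero    = refl
  length-vecsOver xs (suc m) = begin
    length (cartesianProductWith _∷_ xs (vecsOver xs m))
      ≡⟨ length-cartesianProductWith _∷_ xs (vecsOver xs m) ⟩
    length xs * length (vecsOver xs m)
      ≡⟨ cong (length xs *_) (length-vecsOver xs m) ⟩
    length xs * length xs ^ m
      ∎

  vecsOver-unique : ∀ {xs} → Unique xs → ∀ m → Unique (vecsOver xs m)
  vecsOver-unique xs! zero    = All.[] ∷ []
  vecsOver-unique xs! (suc m) =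
    cartesianProductWith⁺ _∷_ ∷-injective xs! (vecsOver-unique xs! m)

  ∈-vecsOver : ∀ {xs} → (∀ x → x ∈ xs) → ∀ {m} (v : Vec A m) → v ∈ vecsOver xs m
  ∈-vecsOver ∈xs []      = here refl
  ∈-vecsOver ∈xs (x ∷ v) = ∈-cartesianProductWith⁺ _∷_ (∈xs x) (∈-vecsOver ∈xs v)

booleans : List Bool
booleans = true ∷ false ∷ []

booleans-unique : Unique booleans
booleans-unique = ((λ ()) All.∷ All.[]) ∷ All.[] ∷ []

∈-booleans : ∀ b → b ∈ booleans
∈-booleans true  = here refl
∈-booleans false = there (here refl)

bitStep : Bool → Step
bitStep true  = D
bitStep false = F

climb : ℕ → Step
climb zero    = F
climb (suc k) = U k

canonicalPath : ∀ {m} → Vec Bool m → Vec Step (suc m)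
canonicalPath v = climb (countᵇ id v) ∷ Vec.map bitStep v

map-bitStep-LukFrom : ∀ {m} (v : Vec Bool m) → LukFrom (countᵇ id v) (Vec.map bitStep v)
map-bitStep-LukFrom []          = end
map-bitStep-LukFrom (true ∷ v)  = down (map-bitStep-LukFrom v)
map-bitStep-LukFrom (false ∷ v) = flat (map-bitStep-LukFrom v)

climb-IsLuk : ∀ h {m} {xs : Vec Step m} → LukFrom h xs → IsLuk (climb h ∷ xs)
climb-IsLuk zero    l = flat l
climb-IsLuk (suc k) {xs = xs} l = up k (subst (λ h → LukFrom h xs) (sym (+-identityʳ (suc k))) l)

canonicalPath-IsLuk : ∀ {m} (v : Vec Bool m) → IsLuk (canonicalPath v)
canonicalPath-IsLuk v = climb-IsLuk (countᵇ id v) (map-bitStep-LukFrom v)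

occD-map-bitStep : ∀ {m} (v : Vec Bool m) → occD (Vec.map bitStep v) ≡ v
occD-map-bitStep []          = refl
occD-map-bitStep (true ∷ v)  = cong (true ∷_) (occD-map-bitStep v)
occD-map-bitStep (false ∷ v) = cong (false ∷_) (occD-map-bitStep v)

isD-climb : ∀ h → isD (climb h) ≡ false
isD-climb zero    = refl
isD-climb (suc h) = refl

occD-canonicalPath : ∀ {m} (v : Vec Bool m) → occD (canonicalPath v) ≡ false ∷ v
occD-canonicalPath v = cong₂ _∷_ (isD-climb (countᵇ id v)) (occD-map-bitStep v)

canonicalPath-≈D-injective : ∀ {m} {v w : Vec Bool m} →
  canonicalPath v ≈D canonicalPath w → v ≡ w
canonicalPath-≈D-injective {v = v} {w} eq =
  ∷-injectiveʳ (trans (sym (occD-canonicalPath v)) (trans eq (occD-canonicalPath w)))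

occD-IsLuk : ∀ {m} {x} {xs : Vec Step m} → IsLuk (x ∷ xs) → occD (x ∷ xs) ≡ false ∷ occD xs
occD-IsLuk (flat _) = refl
occD-IsLuk (up _ _) = refl

≈D-canonicalPath : ∀ {m} {x} {xs : Vec Step m} → IsLuk (x ∷ xs) →
  (x ∷ xs) ≈D canonicalPath (occD xs)
≈D-canonicalPath {xs = xs} l = trans (occD-IsLuk l) (sym (occD-canonicalPath (occD xs)))

theorem3 : ∀ (n : ℕ) → 1 ≤ n →
    Σ (List (Vec Step n)) λ reps →
      All IsLuk reps
      × AllPairs (λ p q → ¬ (p ≈D q)) reps
      × (∀ (p : Vec Step n) → IsLuk p → Any (λ q → p ≈D q) reps)
      × length reps ≡ 2 ^ (n ∸ 1)
theorem3 (suc m) _ =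
  map canonicalPath bitVectors
  , All.map⁺ (All.universal canonicalPath-IsLuk bitVectors)
  , AllPairs.map⁺ (AllPairs.map (λ v≢w eq → v≢w (canonicalPath-≈D-injective eq))
                                (vecsOver-unique booleans-unique m))
  , (λ where
       (x ∷ xs) l → Any.map (λ eq → subst ((x ∷ xs) ≈D_) eq (≈D-canonicalPath l))
                            (∈-map⁺ canonicalPath (∈-vecsOver ∈-booleans (occD xs))))
  , trans (length-map canonicalPath bitVectors) (length-vecsOver booleans m)
  where
  bitVectors : List (Vec Bool m)
  bitVectors = vecsOver booleans m
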